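{- Let $Z\in\mathsf{Pred}$, $k\in\mathbb{Z}$, $z\in\mathsf{Set}_k$. Let $i,j\in\mathbb{Z}$, let $a\in\mathbb{A}_i$, $x\in\mathsf{Set}_i$, $b\in\mathbb{A}_j$, $y\in\mathsf{Set}_j$ with $a,b$ distinct atoms and $a\#y$. Then $Z[a\mapsto x][b\mapsto y]=Z[b\mapsto y][a\mapsto x[b\mapsto y]]$ and $z[a\mapsto x][b\mapsto y]=z[b\mapsto y][a\mapsto x[b\mapsto y]]$.
   Context: Atoms: for each $i\in\mathbb{Z}$ fix a countably infinite set $\mathbb{A}_i$ of atoms, pairwise disjoint, $\mathbb{A}=\bigcup_i\mathbb{A}_i$, $\mathrm{level}(a)=i$ iff $a\in\mathbb{A}_i$. Permutations are finitely-supported level-preserving bijections of $\mathbb{A}$; $(a\ b)$ is the swapping; $\mathrm{supp}(x)$ is the least finite set of atoms such that every permutation fixing it pointwise fixes $x$, and $a\#x$ means $a\notin\mathrm{supp}(x)$. $[a]X$ is nominal atoms-abstraction (binding $a$ in $X$): $[a]X=[b]((b\ a)\cdot X)$ when $b\#X$. Internal syntax: $\mathsf{Pred}$ and $\mathsf{Set}_i$ ($i\in\mathbb{Z}$) are defined inductively: $\mathsf{atm}(a)\in\mathsf{Set}_i$ for $a\in\mathbb{A}_i$; $\mathsf{and}(\mathcal X)\in\mathsf{Pred}$ for finite $\mathcal X\subseteq\mathsf{Pred}$; $\mathsf{neg}(X)$; $\mathsf{all}([a]X)$ for $a\in\mathbb{A}$; $\mathsf{elt}(x,a)\in\mathsf{Pred}$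 for $a\in\mathbb{A}_{i+1}$, $x\in\mathsf{Set}_i$; $\mathsf{st}([a]X)\in\mathsf{Set}_i$ for $a\in\mathbb{A}_{i-1}$, $X\in\mathsf{Pred}$ (an internal comprehension). Sigma-action: for $a\in\mathbb{A}_i$, $x\in\mathsf{Set}_i$, the well-defined operation $Z[a\mapsto x]\in\mathsf{Pred}$, $z[a\mapsto x]\in\mathsf{Set}_k$ is given by (with $b,c$ atoms distinct from $a$): $\mathsf{and}(\mathcal X)[a\mapsto x]=\mathsf{and}(\{X[a\mapsto x]\mid X\in\mathcal X\})$; $\mathsf{neg}(X)[a\mapsto x]=\mathsf{neg}(X[a\mapsto x])$; $\mathsf{all}([b]X)[a\mapsto x]=\mathsf{all}([b](X[a\mapsto x]))$ if $b\#x$; $\mathsf{elt}(y,a)[a\mapsto\mathsf{atm}(n)]=\mathsf{elt}(y[a\mapsto\mathsf{atm}(n)],n)$ for any $n\in\mathbb{A}_i$; $\mathsf{elt}(y,a)[a\mapsto\mathsf{st}([a']X')]=X'[a'\mapsto y[a\mapsto\mathsf{st}([a']X')]]$ for fresh $a'\in\mathbb{A}_{i-1}$; $\mathsf{elt}(y,b)[a\mapsto x]=\mathsf{elt}(y[a\mapsto x],b)$; $\mathsf{atm}(a)[a\mapsto x]=x$; $\mathsf{atm}(b)[a\mapsto x]=\mathsf{atm}(b)$; $\mathsf{st}([c]X)[a\mapsto x]=\mathsf{st}([c](X[a\mapsto x]))$ if $c\#x$. -}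

module Defs where

-- Internal syntax of the paper, in locally-nameless, well-scoped form.
-- Free atoms are named (level , name); bound atoms are de Bruijn variables
-- whose level is recorded in the scope Γ : List ℤ.  Closed terms
-- (Γ = []) are exactly the paper's Pred and Set_i, and syntactic equality
-- of closed terms is equality modulo alpha-equivalence (nominal abstraction).

open import Data.Integer using (ℤ; suc)
open import Data.Nat using (ℕ)
open import Data.List using (List; []; _∷_; _++_)
open import Data.Product using (_×_; _,_)
open import Data.List.Membership.Propositional using (_∉_)
open import Relation.Binary.PropositionalEquality using (_≢_)

-- an atom a ∈ 𝔸_i is represented as (i , n)
Atom : Set
Atom = ℤ × ℕ

data Var : List ℤ → ℤ → Set where
  here  : ∀ {Γ l} → Var (l ∷ Γ) l
  there : ∀ {Γ l m} → Var Γ l → Var (m ∷ Γ) l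

data Name (Γ : List ℤ) (l : ℤ) : Set where
  fr : ℕ → Name Γ l
  bd : Var Γ l → Name Γ l

mutual
  data Pred (Γ : List ℤ) : Set where
    and : List (Pred Γ) → Pred Γ
    neg : Pred Γ → Pred Γ
    all : (ℓ : ℤ) → Pred (ℓ ∷ Γ) → Pred Γ
    elt : ∀ {i} → Sets Γ i → Name Γ (suc i) → Pred Γ

  data Sets (Γ : List ℤ) : ℤ → Set where
    atm : ∀ {l} → Name Γ l → Sets Γ l
    st  : ∀ {i} → Pred (i ∷ Γ) → Sets Γ (suc i)

Ren : List ℤ → List ℤ → Set
Ren Γ Δ = ∀ {l} → Var Γ l → Name Δ l

wkN : ∀ {Δ l m} → Name Δ l → Name (m ∷ Δ) l
wkN (fr n) = fr n
wkN (bd v) = bd (there v)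

lift : ∀ {Γ Δ m} → Ren Γ Δ → Ren (m ∷ Γ) (m ∷ Δ)
lift ρ here      = bd here
lift ρ (there v) = wkN (ρ v)

renN : ∀ {Γ Δ l} → Ren Γ Δ → Name Γ l → Name Δ l
renN ρ (fr n) = fr n
renN ρ (bd v) = ρ v

mutual
  renP : ∀ {Γ Δ} → Ren Γ Δ → Pred Γ → Pred Δ
  renP ρ (and Xs)  = and (renL ρ Xs)
  renP ρ (neg X)   = neg (renP ρ X)
  renP ρ (all ℓ X) = all ℓ (renP (lift ρ) X)
  renP ρ (elt y a) = elt (renS ρ y) (renN ρ a)

  renL : ∀ {Γ Δ} → Ren Γ Δ → List (Pred Γ) → List (Pred Δ)
  renL ρ []       = []
  renL ρ (X ∷ Xs) = renP ρ X ∷ renL ρ Xs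

  renS : ∀ {Γ Δ k} → Ren Γ Δ → Sets Γ k → Sets Δ k
  renS ρ (atm a) = atm (renN ρ a)
  renS ρ (st X)  = st (renP (lift ρ) X)

openR : ∀ {Γ ℓ} → ℕ → Ren (ℓ ∷ Γ) Γ
openR c here      = fr c
openR c (there v) = bd v

openP : ∀ {Γ ℓ} → Pred (ℓ ∷ Γ) → ℕ → Pred Γ
openP X c = renP (openR c) X

-- free atoms (= nominal support of the closed term)
fvN : ∀ {Γ l} → Name Γ l → List Atom
fvN {l = l} (fr n) = (l , n) ∷ []
fvN (bd v) = []

mutual
  fvP : ∀ {Γ} → Pred Γ → List Atom
  fvP (and Xs)  = fvL Xs
  fvP (neg X)   = fvP X
  fvP (all ℓ X) = fvP X
  fvP (elt y a) = fvS y ++ fvN a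

  fvL : ∀ {Γ} → List (Pred Γ) → List Atom
  fvL []       = []
  fvL (X ∷ Xs) = fvP X ++ fvL Xs

  fvS : ∀ {Γ k} → Sets Γ k → List Atom
  fvS (atm a) = fvN a
  fvS (st X)  = fvP X

_#P_ : ∀ {Γ} → Atom → Pred Γ → Set
a #P X = a ∉ fvP X

_#S_ : ∀ {Γ k} → Atom → Sets Γ k → Set
a #S x = a ∉ fvS x

-- Graph of the sigma-action on closed terms:
--   SubP Z n x Z'  means  Z[(l , n) ↦ x] = Z'   (x ∈ Set_l),
--   SubS z n x z'  means  z[(l , n) ↦ x] = z'.
-- Binders are handled by opening with (any) fresh atom, as in the paper.
mutual
  data SubP : ∀ {l : ℤ} → Pred [] → ℕ → Sets [] l → Pred [] → Set where
    s-and : ∀ {l Xs Ys n} {x : Sets [] l} → SubL Xs n x Ys → SubP (and Xs) n x (and Ys)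
    s-neg : ∀ {l X Y n} {x : Sets [] l} → SubP X n x Y → SubP (neg X) n x (neg Y)
    s-all : ∀ {l ℓ} {X Y : Pred (ℓ ∷ [])} {n} {x : Sets [] l} →
      (∀ c → (ℓ , c) ≢ (l , n) → (ℓ , c) #S x → (ℓ , c) #P X → (ℓ , c) #P Y →
         SubP (openP X c) n x (openP Y c)) →
      SubP (all ℓ X) n x (all ℓ Y)
    s-elt-atm : ∀ {i} {y y' : Sets [] i} {n n'} →
      SubS {l = suc i} y n (atm (fr n')) y' →
      SubP {l = suc i} (elt y (fr n)) n (atm (fr n')) (elt y' (fr n'))
    -- elt(y,a)[a ↦ st([a']X')] = X'[a' ↦ y[a ↦ st([a']X')]]  (a' fresh)
    s-elt-st : ∀ {i} {y y' : Sets [] i} {X' : Pred (i ∷ [])} {n} {R : Pred []} →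
      SubS y n (st X') y' →
      (∀ m → (i , m) #P X' → SubP (openP X' m) m y' R) →
      SubP {l = suc i} (elt y (fr n)) n (st X') R
    s-elt-other : ∀ {l i} {y y' : Sets [] i} {m n} {x : Sets [] l} →
      (suc i , m) ≢ (l , n) →
      SubS y n x y' →
      SubP (elt y (fr m)) n x (elt y' (fr m))

  data SubL : ∀ {l : ℤ} → List (Pred []) → ℕ → Sets [] l → List (Pred []) → Set where
    s-[] : ∀ {l n} {x : Sets [] l} → SubL [] n x []
    s-∷  : ∀ {l X Y Xs Ys n} {x : Sets [] l} → SubP X n x Y → SubL Xs n x Ys → SubL (X ∷ Xs) n x (Y ∷ Ys)

  data SubS : ∀ {l k : ℤ} → Sets [] k → ℕ → Sets [] l → Sets [] k → Set where
    s-atm-eq  : ∀ {l n} {x : Sets [] l} → SubS {l = l} {k = l} (atm (fr n)) n x x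
    s-atm-neq : ∀ {l k m n} {x : Sets [] l} → (k , m) ≢ (l , n) → SubS {l = l} {k = k} (atm (fr m)) n x (atm (fr m))
    s-st : ∀ {l i} {X Y : Pred (i ∷ [])} {n} {x : Sets [] l} →
      (∀ c → (i , c) ≢ (l , n) → (i , c) #S x → (i , c) #P X → (i , c) #P Y →
         SubP (openP X c) n x (openP Y c)) →
      SubS (st X) n x (st Y)

-- Induction on the derivation of Z[a ↦ x], nested inside an induction on levels.  The one
-- non-structural step is elt(w,a)[a ↦ st([m]X)] = X[m ↦ w[a ↦ x]] (and its mirror image for
-- b ↦ y): there the claim is needed again for the substitution [m ↦ …], whose atom lies one
-- level below a.  All comprehensions of Z, x and y lie above some floor L, so the distances of
-- the levels of a and b from L bound this recursion.  Since the σ-action is given as a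
-- relation, the argument also needs that it is functional and total (totality by the same
-- level induction), and that an abstraction may be opened at any sufficiently fresh atom,
-- which follows from equivariance under swapping atoms.

module Submission where

open import Data.Empty using (⊥; ⊥-elim)
open import Data.Integer using (ℤ; suc; +_; -[1+_]; _+_; -_; _-_; 0ℤ; _<_; _≤_; ∣_∣; -1ℤ; +<+; -≤+)
open import Data.Integer.Properties
  using (≤-refl; <⇒≱; +-identityʳ; +-identityˡ; +-inverseˡ; +-assoc; +-monoʳ-<; +-monoˡ-<; +-monoˡ-≤;
         suc-+; pred-suc; module ≤-Reasoning)
open import Data.List using (List; []; _∷_; _++_; concat; map)
open import Data.List.Membership.Propositional using (_∈_; _∉_)
open import Data.List.Membership.Propositional.Properties using (∈-++⁺ˡ; ∈-++⁺ʳ; ∈-++⁻; ∈-map⁺; ∈-concat⁺′)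
open import Data.List.Relation.Binary.Subset.Propositional using (_⊆_)
open import Data.List.Relation.Binary.Subset.Propositional.Properties
  using (⊆-refl; ⊆-trans; xs⊆xs++ys; xs⊆ys++xs)
open import Data.List.Relation.Unary.All as All using (All; []; _∷_)
open import Data.List.Relation.Unary.All.Properties using (++⁺; ++⁻ˡ; ++⁻ʳ)
open import Data.List.Relation.Unary.Any as Any using ()
open import Data.Nat as ℕ using (ℕ)
import Data.Nat.Properties as ℕ
open import Data.Nat.Induction using (<-rec)
open import Data.Product using (∃; ∃₂; _×_; _,_; proj₁; proj₂)
open import Data.Product.Properties using (≡-dec)
open import Data.Sum using (_⊎_; inj₁; inj₂; [_,_])
open import Function using (_∘_; case_of_)
open import Relation.Binary.Definitions using (DecidableEquality)
open import Relation.Binary.PropositionalEquality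
  using (_≡_; _≢_; refl; sym; trans; cong; cong₂; subst; subst₂; ≢-sym; module ≡-Reasoning)
open import Relation.Nullary using (Dec; yes; no)

open import Defs

infix 4 _≟A_

_≟A_ : DecidableEquality Atom
_≟A_ = ≡-dec Data.Integer._≟_ ℕ._≟_

freshFor : (ℓ : ℤ) (ps : List Atom) (ass : List (List Atom)) →
           ∃ λ c → All ((ℓ , c) ≢_) ps × All ((ℓ , c) ∉_) ass
freshFor ℓ ps ass =
  c , All.tabulate (λ p∈ps c≡p → c-new (∈-++⁺ˡ (subst (_∈ ps) (sym c≡p) p∈ps)))
    , All.tabulate (λ as∈ass c∈as → c-new (∈-++⁺ʳ ps (∈-concat⁺′ c∈as as∈ass)))
  where
  open import Data.List.Extrema ℕ.≤-totalOrder using (max; xs≤max)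
  names = map proj₂ (concat (ps ∷ ass))
  c = ℕ.suc (max 0 names)
  c-new : (ℓ , c) ∉ concat (ps ∷ ass)
  c-new c∈ = ℕ.n≮n _ (All.lookup (xs≤max 0 names) (∈-map⁺ proj₂ c∈))

-- The three syntactic classes of Defs, indexed so that their mutual recursions are written once.
data Sort : Set where
  pred preds : Sort
  sets : ℤ → Sort

Term : Sort → List ℤ → Set
Term pred     Γ = Pred Γ
Term preds    Γ = List (Pred Γ)
Term (sets k) Γ = Sets Γ k

fv : ∀ s {Γ} → Term s Γ → List Atom
fv pred     = fvP
fv preds    = fvL
fv (sets k) = fvS

ren : ∀ s {Γ Δ} → Ren Γ Δ → Term s Γ → Term s Δ
ren pred     = renP
ren preds    = renL
ren (sets k) = renS

Sub : ∀ s {l} → Term s [] → ℕ → Sets [] l → Term s [] → Set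
Sub pred     = SubP
Sub preds    = SubL
Sub (sets k) = SubS

-- Name maps

-- Unlike a Ren, a name map may also move free atoms (swapping, closing).
NameMap : List ℤ → List ℤ → Set
NameMap Γ Δ = ∀ {l} → Name Γ l → Name Δ l

_∘ᴺ_ : ∀ {Γ Δ Θ} → NameMap Δ Θ → NameMap Γ Δ → NameMap Γ Θ
(φ ∘ᴺ ψ) a = φ (ψ a)

_≗ᴺ_ : ∀ {Γ Δ} → NameMap Γ Δ → NameMap Γ Δ → Set
_≗ᴺ_ {Γ} φ ψ = ∀ {l} (a : Name Γ l) → φ a ≡ ψ a

AgreeOn : ∀ {Γ Δ} → List Atom → NameMap Γ Δ → NameMap Γ Δ → Set
AgreeOn {Γ} as φ ψ = ∀ {l} (a : Name Γ l) → fvN a ⊆ as → φ a ≡ ψ a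

⇑ : ∀ {Γ Δ m} → NameMap Γ Δ → NameMap (m ∷ Γ) (m ∷ Δ)
⇑ φ (fr n)         = wkN (φ (fr n))
⇑ φ (bd here)      = bd here
⇑ φ (bd (there v)) = wkN (φ (bd v))

rename : ∀ s {Γ Δ} → NameMap Γ Δ → Term s Γ → Term s Δ
rename pred     φ (and Xs)      = and (rename preds φ Xs)
rename pred     φ (neg X)       = neg (rename pred φ X)
rename pred     φ (all ℓ X)     = all ℓ (rename pred (⇑ φ) X)
rename pred     φ (elt {i} y a) = elt (rename (sets i) φ y) (φ a)
rename preds    φ []            = []
rename preds    φ (X ∷ Xs)      = rename pred φ X ∷ rename preds φ Xs
rename (sets k) φ (atm a)       = atm (φ a)
rename (sets k) φ (st X)        = st (rename pred (⇑ φ) X)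

agreeOn-⊆ : ∀ {Γ Δ as bs} {φ ψ : NameMap Γ Δ} → as ⊆ bs → AgreeOn bs φ ψ → AgreeOn as φ ψ
agreeOn-⊆ as⊆bs φ≈ψ a a⊆as = φ≈ψ a (⊆-trans a⊆as as⊆bs)

⇑-agree : ∀ {Γ Δ m as} {φ ψ : NameMap Γ Δ} → AgreeOn as φ ψ → AgreeOn as (⇑ {m = m} φ) (⇑ ψ)
⇑-agree φ≈ψ (fr n)         n⊆ = cong wkN (φ≈ψ (fr n) n⊆)
⇑-agree φ≈ψ (bd here)      _  = refl
⇑-agree φ≈ψ (bd (there v)) _  = cong wkN (φ≈ψ (bd v) (λ ()))

rename-cong : ∀ s {Γ Δ} {φ ψ : NameMap Γ Δ} (t : Term s Γ) → AgreeOn (fv s t) φ ψ →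
              rename s φ t ≡ rename s ψ t
rename-cong pred (and Xs) φ≈ψ = cong and (rename-cong preds Xs φ≈ψ)
rename-cong pred (neg X) φ≈ψ = cong neg (rename-cong pred X φ≈ψ)
rename-cong pred (all ℓ X) φ≈ψ = cong (all ℓ) (rename-cong pred X (⇑-agree φ≈ψ))
rename-cong pred (elt {i} y a) φ≈ψ =
  cong₂ elt (rename-cong (sets i) y (agreeOn-⊆ (xs⊆xs++ys _ _) φ≈ψ)) (φ≈ψ a (xs⊆ys++xs _ _))
rename-cong preds [] φ≈ψ = refl
rename-cong preds (X ∷ Xs) φ≈ψ =
  cong₂ _∷_ (rename-cong pred X (agreeOn-⊆ (xs⊆xs++ys _ _) φ≈ψ))
            (rename-cong preds Xs (agreeOn-⊆ (xs⊆ys++xs _ (fvP X)) φ≈ψ))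
rename-cong (sets k) (atm a) φ≈ψ = cong atm (φ≈ψ a ⊆-refl)
rename-cong (sets k) (st X) φ≈ψ = cong st (rename-cong pred X (⇑-agree φ≈ψ))

⇑-wkN : ∀ {Γ Δ m l} (φ : NameMap Γ Δ) (a : Name Γ l) → ⇑ {m = m} φ (wkN a) ≡ wkN (φ a)
⇑-wkN φ (fr n) = refl
⇑-wkN φ (bd v) = refl

⇑-∘ : ∀ {Γ Δ Θ m} (φ : NameMap Δ Θ) (ψ : NameMap Γ Δ) → (⇑ {m = m} φ ∘ᴺ ⇑ ψ) ≗ᴺ ⇑ (φ ∘ᴺ ψ)
⇑-∘ φ ψ (fr n)         = ⇑-wkN φ (ψ (fr n))
⇑-∘ φ ψ (bd here)      = refl
⇑-∘ φ ψ (bd (there v)) = ⇑-wkN φ (ψ (bd v))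

rename-ext : ∀ s {Γ Δ} {φ ψ : NameMap Γ Δ} (t : Term s Γ) → φ ≗ᴺ ψ → rename s φ t ≡ rename s ψ t
rename-ext s t φ≗ψ = rename-cong s t (λ a _ → φ≗ψ a)

rename-∘ : ∀ s {Γ Δ Θ} (φ : NameMap Δ Θ) (ψ : NameMap Γ Δ) (t : Term s Γ) →
           rename s φ (rename s ψ t) ≡ rename s (φ ∘ᴺ ψ) t
rename-∘ pred φ ψ (and Xs) = cong and (rename-∘ preds φ ψ Xs)
rename-∘ pred φ ψ (neg X) = cong neg (rename-∘ pred φ ψ X)
rename-∘ pred φ ψ (all ℓ X) =
  cong (all ℓ) (trans (rename-∘ pred (⇑ φ) (⇑ ψ) X) (rename-ext pred X (⇑-∘ φ ψ)))
rename-∘ pred φ ψ (elt {i} y a) = cong (λ y → elt y (φ (ψ a))) (rename-∘ (sets i) φ ψ y)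
rename-∘ preds φ ψ [] = refl
rename-∘ preds φ ψ (X ∷ Xs) = cong₂ _∷_ (rename-∘ pred φ ψ X) (rename-∘ preds φ ψ Xs)
rename-∘ (sets k) φ ψ (atm a) = refl
rename-∘ (sets k) φ ψ (st X) =
  cong st (trans (rename-∘ pred (⇑ φ) (⇑ ψ) X) (rename-ext pred X (⇑-∘ φ ψ)))

idᴺ : ∀ {Γ} → NameMap Γ Γ
idᴺ a = a

⇑-id : ∀ {Γ m} → ⇑ {Γ} {m = m} idᴺ ≗ᴺ idᴺ
⇑-id (fr n)         = refl
⇑-id (bd here)      = refl
⇑-id (bd (there v)) = refl

rename-id : ∀ s {Γ} (t : Term s Γ) → rename s idᴺ t ≡ t
rename-id pred (and Xs) = cong and (rename-id preds Xs)
rename-id pred (neg X) = cong neg (rename-id pred X)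
rename-id pred (all ℓ X) = cong (all ℓ) (trans (rename-ext pred X ⇑-id) (rename-id pred X))
rename-id pred (elt {i} y a) = cong (λ y → elt y a) (rename-id (sets i) y)
rename-id preds [] = refl
rename-id preds (X ∷ Xs) = cong₂ _∷_ (rename-id pred X) (rename-id preds Xs)
rename-id (sets k) (atm a) = refl
rename-id (sets k) (st X) = cong st (trans (rename-ext pred X ⇑-id) (rename-id pred X))

renN-lift : ∀ {Γ Δ m} (ρ : Ren Γ Δ) → renN (lift {m = m} ρ) ≗ᴺ ⇑ (renN ρ)
renN-lift ρ (fr n)         = refl
renN-lift ρ (bd here)      = refl
renN-lift ρ (bd (there v)) = refl

ren≡rename : ∀ s {Γ Δ} (ρ : Ren Γ Δ) (t : Term s Γ) → ren s ρ t ≡ rename s (renN ρ) t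
ren≡rename pred ρ (and Xs) = cong and (ren≡rename preds ρ Xs)
ren≡rename pred ρ (neg X) = cong neg (ren≡rename pred ρ X)
ren≡rename pred ρ (all ℓ X) =
  cong (all ℓ) (trans (ren≡rename pred (lift ρ) X) (rename-ext pred X (renN-lift ρ)))
ren≡rename pred ρ (elt {i} y a) = cong (λ y → elt y (renN ρ a)) (ren≡rename (sets i) ρ y)
ren≡rename preds ρ [] = refl
ren≡rename preds ρ (X ∷ Xs) = cong₂ _∷_ (ren≡rename pred ρ X) (ren≡rename preds ρ Xs)
ren≡rename (sets k) ρ (atm a) = refl
ren≡rename (sets k) ρ (st X) =
  cong st (trans (ren≡rename pred (lift ρ) X) (rename-ext pred X (renN-lift ρ)))

Preimage : ∀ {Γ Δ} → NameMap Γ Δ → List Atom → Atom → Set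
Preimage {Γ} φ as a = ∃₂ λ l (b : Name Γ l) → fvN b ⊆ as × a ∈ fvN (φ b)

preimage-⊆ : ∀ {Γ Δ as bs a} {φ : NameMap Γ Δ} → as ⊆ bs → Preimage φ as a → Preimage φ bs a
preimage-⊆ as⊆bs (l , b , b⊆as , a∈) = l , b , ⊆-trans b⊆as as⊆bs , a∈

fvN-wkN : ∀ {Δ l m} (a : Name Δ l) → fvN (wkN {m = m} a) ≡ fvN a
fvN-wkN (fr n) = refl
fvN-wkN (bd v) = refl

preimage-⇑ : ∀ {Γ Δ m as a} {φ : NameMap Γ Δ} → Preimage (⇑ {m = m} φ) as a → Preimage φ as a
preimage-⇑ {φ = φ} (l , fr n , n⊆as , a∈) = l , fr n , n⊆as , subst (_ ∈_) (fvN-wkN (φ (fr n))) a∈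
preimage-⇑ (l , bd here , _ , ())
preimage-⇑ {φ = φ} (l , bd (there v) , _ , a∈) = l , bd v , (λ ()) , subst (_ ∈_) (fvN-wkN (φ (bd v))) a∈

∈-fv-rename : ∀ s {Γ Δ} (φ : NameMap Γ Δ) (t : Term s Γ) {a} →
              a ∈ fv s (rename s φ t) → Preimage φ (fv s t) a
∈-fv-rename pred φ (and Xs) a∈ = ∈-fv-rename preds φ Xs a∈
∈-fv-rename pred φ (neg X) a∈ = ∈-fv-rename pred φ X a∈
∈-fv-rename pred φ (all ℓ X) a∈ = preimage-⇑ (∈-fv-rename pred (⇑ φ) X a∈)
∈-fv-rename pred φ (elt {i} y b) a∈ with ∈-++⁻ (fvS (rename (sets i) φ y)) a∈
... | inj₁ a∈y = preimage-⊆ (xs⊆xs++ys _ _) (∈-fv-rename (sets i) φ y a∈y)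
... | inj₂ a∈b = _ , b , xs⊆ys++xs _ _ , a∈b
∈-fv-rename preds φ (X ∷ Xs) a∈ with ∈-++⁻ (fvP (rename pred φ X)) a∈
... | inj₁ a∈X  = preimage-⊆ (xs⊆xs++ys _ _) (∈-fv-rename pred φ X a∈X)
... | inj₂ a∈Xs = preimage-⊆ (xs⊆ys++xs _ (fvP X)) (∈-fv-rename preds φ Xs a∈Xs)
∈-fv-rename (sets k) φ (atm b) a∈ = _ , b , ⊆-refl , a∈
∈-fv-rename (sets k) φ (st X) a∈ = preimage-⇑ (∈-fv-rename pred (⇑ φ) X a∈)

-- Opening and closing abstractions

openᴺ : ∀ {ℓ} → ℕ → NameMap (ℓ ∷ []) []
openᴺ c = renN (openR c)

openP≡rename : ∀ {ℓ} (X : Pred (ℓ ∷ [])) c → openP X c ≡ rename pred (openᴺ c) X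
openP≡rename X c = ren≡rename pred (openR c) X

openP-rename-⇑ : ∀ {Γ ℓ} (φ : NameMap Γ []) (X : Pred (ℓ ∷ Γ)) c →
                 openP (rename pred (⇑ φ) X) c ≡ rename pred (openᴺ c ∘ᴺ ⇑ φ) X
openP-rename-⇑ φ X c = trans (openP≡rename (rename pred (⇑ φ) X) c) (rename-∘ pred (openᴺ c) (⇑ φ) X)

∈-fv-openP : ∀ {ℓ} (X : Pred (ℓ ∷ [])) c {a} → a ∈ fvP (openP X c) → a ≡ (ℓ , c) ⊎ a ∈ fvP X
∈-fv-openP X c a∈ with ∈-fv-rename pred (openᴺ c) X (subst (λ Y → _ ∈ fvP Y) (openP≡rename X c) a∈)
... | _ , fr n , n⊆X , Any.here refl = inj₂ (n⊆X (Any.here refl))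
... | _ , fr n , _ , Any.there ()
... | _ , bd here , _ , Any.here refl = inj₁ refl
... | _ , bd here , _ , Any.there ()

#-openP : ∀ {ℓ} (X : Pred (ℓ ∷ [])) c {a} → a ≢ (ℓ , c) → a ∉ fvP X → a ∉ fvP (openP X c)
#-openP X c a≢c a#X = [ a≢c , a#X ] ∘ ∈-fv-openP X c

closeᴺ : ∀ ℓ → ℕ → NameMap [] (ℓ ∷ [])
closeᴺ ℓ c {l} (fr n) with (l , n) ≟A (ℓ , c)
... | yes refl = bd here
... | no _     = fr n

close : ∀ ℓ → ℕ → Pred [] → Pred (ℓ ∷ [])
close ℓ c = rename pred (closeᴺ ℓ c)

closeᴺ-self : ∀ ℓ c → closeᴺ ℓ c (fr c) ≡ bd here
closeᴺ-self ℓ c with (ℓ , c) ≟A (ℓ , c)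
... | yes refl = refl
... | no c≢c   = ⊥-elim (c≢c refl)

closeᴺ-other : ∀ ℓ c {l n} → (l , n) ≢ (ℓ , c) → closeᴺ ℓ c {l} (fr n) ≡ fr n
closeᴺ-other ℓ c {l} {n} n≢c with (l , n) ≟A (ℓ , c)
... | yes refl = ⊥-elim (n≢c refl)
... | no _     = refl

#-closeᴺ : ∀ ℓ c l n → (ℓ , c) ∉ fvN (closeᴺ ℓ c {l} (fr n))
#-closeᴺ ℓ c l n c∈ with (l , n) ≟A (ℓ , c)
#-closeᴺ ℓ c l n () | yes refl
#-closeᴺ ℓ c l n (Any.here c≡n) | no n≢c = n≢c (sym c≡n)

#-close : ∀ ℓ c (Y : Pred []) → (ℓ , c) ∉ fvP (close ℓ c Y)
#-close ℓ c Y c∈ with ∈-fv-rename pred (closeᴺ ℓ c) Y c∈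
... | l , fr n , _ , c∈n = #-closeᴺ ℓ c l n c∈n

openP-close : ∀ ℓ c (Y : Pred []) → openP (close ℓ c Y) c ≡ Y
openP-close ℓ c Y = begin
  openP (close ℓ c Y) c                   ≡⟨ openP≡rename (close ℓ c Y) c ⟩
  rename pred (openᴺ c) (close ℓ c Y)     ≡⟨ rename-∘ pred (openᴺ c) (closeᴺ ℓ c) Y ⟩
  rename pred (openᴺ c ∘ᴺ closeᴺ ℓ c) Y   ≡⟨ rename-ext pred Y open∘close ⟩
  rename pred idᴺ Y                       ≡⟨ rename-id pred Y ⟩
  Y                                       ∎
  where
  open ≡-Reasoning
  open∘close : (openᴺ c ∘ᴺ closeᴺ ℓ c) ≗ᴺ idᴺ
  open∘close {l} (fr n) with (l , n) ≟A (ℓ , c)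
  ... | yes refl = refl
  ... | no _     = refl

close-openP : ∀ ℓ c (X : Pred (ℓ ∷ [])) → (ℓ , c) ∉ fvP X → close ℓ c (openP X c) ≡ X
close-openP ℓ c X c#X = begin
  close ℓ c (openP X c)                   ≡⟨ cong (close ℓ c) (openP≡rename X c) ⟩
  close ℓ c (rename pred (openᴺ c) X)     ≡⟨ rename-∘ pred (closeᴺ ℓ c) (openᴺ c) X ⟩
  rename pred (closeᴺ ℓ c ∘ᴺ openᴺ c) X   ≡⟨ rename-cong pred X close∘open ⟩
  rename pred idᴺ X                       ≡⟨ rename-id pred X ⟩
  X                                       ∎
  where
  open ≡-Reasoning
  close∘open : AgreeOn (fvP X) (closeᴺ ℓ c ∘ᴺ openᴺ c) idᴺ
  close∘open (fr n) n⊆X = closeᴺ-other ℓ c (λ n≡c → c#X (subst (_∈ fvP X) n≡c (n⊆X (Any.here refl))))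
  close∘open (bd here) _ = closeᴺ-self ℓ c

openP-injective : ∀ {ℓ c} {X Y : Pred (ℓ ∷ [])} → (ℓ , c) ∉ fvP X → (ℓ , c) ∉ fvP Y →
                  openP X c ≡ openP Y c → X ≡ Y
openP-injective {ℓ} {c} {X} {Y} c#X c#Y X≡Y = begin
  X                      ≡⟨ close-openP ℓ c X c#X ⟨
  close ℓ c (openP X c)  ≡⟨ cong (close ℓ c) X≡Y ⟩
  close ℓ c (openP Y c)  ≡⟨ close-openP ℓ c Y c#Y ⟩
  Y                      ∎
  where open ≡-Reasoning

-- Swapping two atoms of the same level

swapName : ℤ → ℕ → ℕ → ℤ → ℕ → ℕ
swapName ℓ c d l n with (l , n) ≟A (ℓ , c) | (l , n) ≟A (ℓ , d)
... | yes _ | _     = d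
... | no _  | yes _ = c
... | no _  | no _  = n

swapAtom : ℤ → ℕ → ℕ → Atom → Atom
swapAtom ℓ c d (l , n) = l , swapName ℓ c d l n

swapName-left : ∀ ℓ c d → swapName ℓ c d ℓ c ≡ d
swapName-left ℓ c d with (ℓ , c) ≟A (ℓ , c) | (ℓ , c) ≟A (ℓ , d)
... | yes _  | _ = refl
... | no c≢c | _ = ⊥-elim (c≢c refl)

swapName-right : ∀ ℓ c d → swapName ℓ c d ℓ d ≡ c
swapName-right ℓ c d with (ℓ , d) ≟A (ℓ , c) | (ℓ , d) ≟A (ℓ , d)
... | yes d≡c | _      = cong proj₂ d≡c
... | no _    | yes _  = refl
... | no _    | no d≢d = ⊥-elim (d≢d refl)

swapAtom-fresh : ∀ ℓ c d {a} → a ≢ (ℓ , c) → a ≢ (ℓ , d) → swapAtom ℓ c d a ≡ a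
swapAtom-fresh ℓ c d {l , n} a≢c a≢d with (l , n) ≟A (ℓ , c) | (l , n) ≟A (ℓ , d)
... | yes a≡c | _       = ⊥-elim (a≢c a≡c)
... | no _    | yes a≡d = ⊥-elim (a≢d a≡d)
... | no _    | no _    = refl

swapAtom-involutive : ∀ ℓ c d a → swapAtom ℓ c d (swapAtom ℓ c d a) ≡ a
swapAtom-involutive ℓ c d a = by-cases (a ≟A (ℓ , c)) (a ≟A (ℓ , d))
  where
  π = swapAtom ℓ c d
  by-cases : Dec (a ≡ (ℓ , c)) → Dec (a ≡ (ℓ , d)) → π (π a) ≡ a
  by-cases (yes a≡c) _ =
    subst (λ a → π (π a) ≡ a) (sym a≡c) (cong (ℓ ,_) (trans (cong (swapName ℓ c d ℓ) (swapName-left ℓ c d))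
                                                               (swapName-right ℓ c d)))
  by-cases (no _) (yes a≡d) =
    subst (λ a → π (π a) ≡ a) (sym a≡d) (cong (ℓ ,_) (trans (cong (swapName ℓ c d ℓ) (swapName-right ℓ c d))
                                                               (swapName-left ℓ c d)))
  by-cases (no a≢c) (no a≢d) =
    trans (cong π (swapAtom-fresh ℓ c d a≢c a≢d)) (swapAtom-fresh ℓ c d a≢c a≢d)

swapAtom-≢ : ∀ ℓ c d {a b} → a ≢ b → swapAtom ℓ c d a ≢ swapAtom ℓ c d b
swapAtom-≢ ℓ c d {a} {b} a≢b πa≡πb = a≢b (begin
  a                                    ≡⟨ swapAtom-involutive ℓ c d a ⟨
  swapAtom ℓ c d (swapAtom ℓ c d a)    ≡⟨ cong (swapAtom ℓ c d) πa≡πb ⟩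
  swapAtom ℓ c d (swapAtom ℓ c d b)    ≡⟨ swapAtom-involutive ℓ c d b ⟩
  b                                    ∎)
  where open ≡-Reasoning

swapᴺ : ∀ {Γ} → ℤ → ℕ → ℕ → NameMap Γ Γ
swapᴺ ℓ c d {l} (fr n) = fr (swapName ℓ c d l n)
swapᴺ ℓ c d     (bd v) = bd v

swap : ∀ s {Γ} → ℤ → ℕ → ℕ → Term s Γ → Term s Γ
swap s ℓ c d = rename s (swapᴺ ℓ c d)

rename-⇑-swapᴺ : ∀ {Γ m} ℓ c d (X : Pred (m ∷ Γ)) → rename pred (⇑ (swapᴺ ℓ c d)) X ≡ swap pred ℓ c d X
rename-⇑-swapᴺ ℓ c d X = rename-ext pred X ⇑-swapᴺ
  where
  ⇑-swapᴺ : ⇑ (swapᴺ ℓ c d) ≗ᴺ swapᴺ ℓ c d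
  ⇑-swapᴺ (fr n)         = refl
  ⇑-swapᴺ (bd here)      = refl
  ⇑-swapᴺ (bd (there v)) = refl

swap-involutive : ∀ s {Γ} ℓ c d (t : Term s Γ) → swap s ℓ c d (swap s ℓ c d t) ≡ t
swap-involutive s ℓ c d t = begin
  swap s ℓ c d (swap s ℓ c d t)                 ≡⟨ rename-∘ s (swapᴺ ℓ c d) (swapᴺ ℓ c d) t ⟩
  rename s (swapᴺ ℓ c d ∘ᴺ swapᴺ ℓ c d) t       ≡⟨ rename-ext s t π∘π ⟩
  rename s idᴺ t                                ≡⟨ rename-id s t ⟩
  t                                             ∎
  where
  open ≡-Reasoning
  π∘π : (swapᴺ ℓ c d ∘ᴺ swapᴺ ℓ c d) ≗ᴺ idᴺ
  π∘π {l} (fr n) = cong (fr ∘ proj₂) (swapAtom-involutive ℓ c d (l , n))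
  π∘π (bd v) = refl

swap-fresh : ∀ s {Γ} ℓ c d (t : Term s Γ) → (ℓ , c) ∉ fv s t → (ℓ , d) ∉ fv s t → swap s ℓ c d t ≡ t
swap-fresh s ℓ c d t c#t d#t = trans (rename-cong s t π≈id) (rename-id s t)
  where
  π≈id : AgreeOn (fv s t) (swapᴺ ℓ c d) idᴺ
  π≈id (fr n) n⊆t = cong (fr ∘ proj₂) (swapAtom-fresh ℓ c d (λ n≡c → c#t (subst (_∈ fv s t) n≡c n∈t))
                                                            (λ n≡d → d#t (subst (_∈ fv s t) n≡d n∈t)))
    where n∈t = n⊆t (Any.here refl)
  π≈id (bd v) _ = refl

swap-openP : ∀ ℓ c d {ℓ′} (X : Pred (ℓ′ ∷ [])) e →
             swap pred ℓ c d (openP X e) ≡ openP (swap pred ℓ c d X) (swapName ℓ c d ℓ′ e)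
swap-openP ℓ c d {ℓ′} X e = begin
  swap pred ℓ c d (openP X e)                    ≡⟨ cong (swap pred ℓ c d) (openP≡rename X e) ⟩
  rename pred (swapᴺ ℓ c d) (rename pred (openᴺ e) X)
                                                 ≡⟨ rename-∘ pred (swapᴺ ℓ c d) (openᴺ e) X ⟩
  rename pred (swapᴺ ℓ c d ∘ᴺ openᴺ e) X         ≡⟨ rename-ext pred X π∘open ⟩
  rename pred (openᴺ πe ∘ᴺ swapᴺ ℓ c d) X        ≡⟨ rename-∘ pred (openᴺ πe) (swapᴺ ℓ c d) X ⟨
  rename pred (openᴺ πe) (swap pred ℓ c d X)     ≡⟨ openP≡rename (swap pred ℓ c d X) πe ⟨
  openP (swap pred ℓ c d X) πe                   ∎
  where
  open ≡-Reasoning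
  πe = swapName ℓ c d ℓ′ e
  π∘open : (swapᴺ ℓ c d ∘ᴺ openᴺ e) ≗ᴺ (openᴺ πe ∘ᴺ swapᴺ ℓ c d)
  π∘open (fr n)    = refl
  π∘open (bd here) = refl

∈-fv-swap : ∀ s {Γ} ℓ c d (t : Term s Γ) {a} → a ∈ fv s (swap s ℓ c d t) → swapAtom ℓ c d a ∈ fv s t
∈-fv-swap s ℓ c d t a∈ with ∈-fv-rename s (swapᴺ ℓ c d) t a∈
... | l , fr n , n⊆t , Any.here refl =
  subst (_∈ fv s t) (sym (swapAtom-involutive ℓ c d (l , n))) (n⊆t (Any.here refl))
... | _ , fr n , _ , Any.there ()

#-unswap : ∀ s {Γ} ℓ c d (t : Term s Γ) {a} → a ∉ fv s (swap s ℓ c d t) → swapAtom ℓ c d a ∉ fv s t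
#-unswap s ℓ c d t {a} a# πa∈ = a# (subst (_∈ fv s (swap s ℓ c d t)) (swapAtom-involutive ℓ c d a) ππa∈)
  where
  ππa∈ = ∈-fv-swap s ℓ c d (swap s ℓ c d t)
           (subst (λ u → swapAtom ℓ c d a ∈ fv s u) (sym (swap-involutive s ℓ c d t)) πa∈)

#-swap : ∀ s {Γ} ℓ c d (t : Term s Γ) {a} → swapAtom ℓ c d a ∉ fv s t → a ∉ fv s (swap s ℓ c d t)
#-swap s ℓ c d t πa# a∈ = πa# (∈-fv-swap s ℓ c d t a∈)

swap-openP-fresh : ∀ {ℓ c₀ c} (X : Pred (ℓ ∷ [])) → (ℓ , c₀) ∉ fvP X → (ℓ , c) ∉ fvP X →
                   swap pred ℓ c₀ c (openP X c₀) ≡ openP X c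
swap-openP-fresh {ℓ} {c₀} {c} X c₀#X c#X =
  trans (swap-openP ℓ c₀ c X c₀)
        (cong₂ openP (swap-fresh pred ℓ c₀ c X c₀#X c#X) (swapName-left ℓ c₀ c))

swap-openP-⇑ : ∀ ℓ c d {ℓ′} (X : Pred (ℓ′ ∷ [])) e →
               swap pred ℓ c d (openP X (swapName ℓ c d ℓ′ e)) ≡ openP (rename pred (⇑ (swapᴺ ℓ c d)) X) e
swap-openP-⇑ ℓ c d {ℓ′} X e =
  trans (swap-openP ℓ c d X _)
        (cong₂ openP (sym (rename-⇑-swapᴺ ℓ c d X)) (cong proj₂ (swapAtom-involutive ℓ c d (ℓ′ , e))))

#-unswap-⇑ : ∀ ℓ c d {ℓ′} (X : Pred (ℓ′ ∷ [])) {a} → a ∉ fvP (rename pred (⇑ (swapᴺ ℓ c d)) X) →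
             swapAtom ℓ c d a ∉ fvP X
#-unswap-⇑ ℓ c d X a# = #-unswap pred ℓ c d X (subst (λ W → _ ∉ fvP W) (rename-⇑-swapᴺ ℓ c d X) a#)

-- The substitution relation

-- ([c]X)[n ↦ x] = [c]Y, the premise of s-all and s-st.
SubAbs : ∀ ℓ {l} → Pred (ℓ ∷ []) → ℕ → Sets [] l → Pred (ℓ ∷ []) → Set
SubAbs ℓ {l} X n x Y = ∀ c → (ℓ , c) ≢ (l , n) → (ℓ , c) #S x → (ℓ , c) #P X → (ℓ , c) #P Y →
                       SubP (openP X c) n x (openP Y c)

-- X[m ↦ y] = R for the atom m bound by X, the premise of s-elt-st.
SubInst : ∀ i → Pred (i ∷ []) → Sets [] i → Pred [] → Set
SubInst i X y R = ∀ m → (i , m) #P X → SubP (openP X m) m y R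

Sub-resp : ∀ s {l} {Z Z′ : Term s []} {n n′} {x x′ : Sets [] l} {Y Y′} →
           Z ≡ Z′ → n ≡ n′ → x ≡ x′ → Y ≡ Y′ → Sub s Z n x Y → Sub s Z′ n′ x′ Y′
Sub-resp s refl refl refl refl D = D

mutual
  Sub-functional : ∀ s {l} {Z : Term s []} {n} {x : Sets [] l} {Y₁ Y₂} →
                   Sub s Z n x Y₁ → Sub s Z n x Y₂ → Y₁ ≡ Y₂
  Sub-functional pred (s-and D) (s-and E) = cong and (Sub-functional preds D E)
  Sub-functional pred (s-neg D) (s-neg E) = cong neg (Sub-functional pred D E)
  Sub-functional pred (s-all D) (s-all E) = cong (all _) (SubAbs-functional D E)
  Sub-functional pred (s-elt-atm D) (s-elt-atm E) = cong (λ y → elt y _) (Sub-functional (sets _) D E)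
  Sub-functional pred (s-elt-atm _) (s-elt-other n≢n _) = ⊥-elim (n≢n refl)
  Sub-functional pred (s-elt-st D P) (s-elt-st E Q) with Sub-functional (sets _) D E
  ... | refl = SubInst-functional P Q
  Sub-functional pred (s-elt-st _ _) (s-elt-other n≢n _) = ⊥-elim (n≢n refl)
  Sub-functional pred (s-elt-other n≢n _) (s-elt-atm _) = ⊥-elim (n≢n refl)
  Sub-functional pred (s-elt-other n≢n _) (s-elt-st _ _) = ⊥-elim (n≢n refl)
  Sub-functional pred (s-elt-other _ D) (s-elt-other _ E) = cong (λ y → elt y _) (Sub-functional (sets _) D E)
  Sub-functional preds s-[] s-[] = refl
  Sub-functional preds (s-∷ D Ds) (s-∷ E Es) =
    cong₂ _∷_ (Sub-functional pred D E) (Sub-functional preds Ds Es)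
  Sub-functional (sets k) s-atm-eq s-atm-eq = refl
  Sub-functional (sets k) s-atm-eq (s-atm-neq n≢n) = ⊥-elim (n≢n refl)
  Sub-functional (sets k) (s-atm-neq n≢n) s-atm-eq = ⊥-elim (n≢n refl)
  Sub-functional (sets k) (s-atm-neq _) (s-atm-neq _) = refl
  Sub-functional (sets k) (s-st D) (s-st E) = cong st (SubAbs-functional D E)

  SubAbs-functional : ∀ {ℓ l} {X : Pred (ℓ ∷ [])} {n} {x : Sets [] l} {Y₁ Y₂} →
                      SubAbs ℓ X n x Y₁ → SubAbs ℓ X n x Y₂ → Y₁ ≡ Y₂
  SubAbs-functional {ℓ} {l} {X} {n} {x} {Y₁} {Y₂} D E =
    case freshFor ℓ ((l , n) ∷ []) (fvS x ∷ fvP X ∷ fvP Y₁ ∷ fvP Y₂ ∷ []) of λ where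
      (c , c≢n ∷ [] , c#x ∷ c#X ∷ c#Y₁ ∷ c#Y₂ ∷ []) →
        openP-injective c#Y₁ c#Y₂ (Sub-functional pred (D c c≢n c#x c#X c#Y₁) (E c c≢n c#x c#X c#Y₂))

  SubInst-functional : ∀ {i} {X : Pred (i ∷ [])} {y R₁ R₂} → SubInst i X y R₁ → SubInst i X y R₂ → R₁ ≡ R₂
  SubInst-functional {i} {X} P Q = case freshFor i [] (fvP X ∷ []) of λ where
    (m , [] , m#X ∷ []) → Sub-functional pred (P m m#X) (Q m m#X)

mutual
  Sub-swap : ∀ s ℓ c d {l} {Z : Term s []} {n} {x : Sets [] l} {Y} → Sub s Z n x Y →
             Sub s (swap s ℓ c d Z) (swapName ℓ c d l n) (swap (sets l) ℓ c d x) (swap s ℓ c d Y)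
  Sub-swap pred ℓ c d (s-and D) = s-and (Sub-swap preds ℓ c d D)
  Sub-swap pred ℓ c d (s-neg D) = s-neg (Sub-swap pred ℓ c d D)
  Sub-swap pred ℓ c d (s-all D) = s-all (SubAbs-swap ℓ c d D)
  Sub-swap pred ℓ c d (s-elt-atm D) = s-elt-atm (Sub-swap (sets _) ℓ c d D)
  Sub-swap pred ℓ c d (s-elt-st D P) = s-elt-st (Sub-swap (sets _) ℓ c d D) (SubInst-swap ℓ c d P)
  Sub-swap pred ℓ c d (s-elt-other m≢n D) = s-elt-other (swapAtom-≢ ℓ c d m≢n) (Sub-swap (sets _) ℓ c d D)
  Sub-swap preds ℓ c d s-[] = s-[]
  Sub-swap preds ℓ c d (s-∷ D Ds) = s-∷ (Sub-swap pred ℓ c d D) (Sub-swap preds ℓ c d Ds)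
  Sub-swap (sets k) ℓ c d s-atm-eq = s-atm-eq
  Sub-swap (sets k) ℓ c d (s-atm-neq m≢n) = s-atm-neq (swapAtom-≢ ℓ c d m≢n)
  Sub-swap (sets k) ℓ c d (s-st D) = s-st (SubAbs-swap ℓ c d D)

  SubAbs-swap : ∀ ℓ c d {ℓ′ l} {X : Pred (ℓ′ ∷ [])} {n} {x : Sets [] l} {Y} → SubAbs ℓ′ X n x Y →
                SubAbs ℓ′ (rename pred (⇑ (swapᴺ ℓ c d)) X) (swapName ℓ c d l n) (swap (sets l) ℓ c d x)
                          (rename pred (⇑ (swapᴺ ℓ c d)) Y)
  SubAbs-swap ℓ c d {ℓ′} {l} {X} {n} {x} {Y} D e e≢πn e#πx e#πX e#πY =
    Sub-resp pred (swap-openP-⇑ ℓ c d X e) refl refl (swap-openP-⇑ ℓ c d Y e)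
      (Sub-swap pred ℓ c d (D _ πe≢n (#-unswap (sets l) ℓ c d x e#πx)
                                     (#-unswap-⇑ ℓ c d X e#πX) (#-unswap-⇑ ℓ c d Y e#πY)))
    where
    πe≢n : swapAtom ℓ c d (ℓ′ , e) ≢ (l , n)
    πe≢n = subst (swapAtom ℓ c d (ℓ′ , e) ≢_) (swapAtom-involutive ℓ c d (l , n)) (swapAtom-≢ ℓ c d e≢πn)

  SubInst-swap : ∀ ℓ c d {i} {X : Pred (i ∷ [])} {y R} → SubInst i X y R →
                 SubInst i (rename pred (⇑ (swapᴺ ℓ c d)) X) (swap (sets i) ℓ c d y) (swap pred ℓ c d R)
  SubInst-swap ℓ c d {i} {X} P m m#πX =
    Sub-resp pred (swap-openP-⇑ ℓ c d X m) (cong proj₂ (swapAtom-involutive ℓ c d (i , m))) refl refl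
      (Sub-swap pred ℓ c d (P _ (#-unswap-⇑ ℓ c d X m#πX)))

-- Swapping c₀ with c fixes n, x, X and Y, and turns the instance at c₀ into the one at c.
SubAbs-fromInstance : ∀ {ℓ l c₀} {X : Pred (ℓ ∷ [])} {n} {x : Sets [] l} {Y} →
                      (ℓ , c₀) ≢ (l , n) → (ℓ , c₀) #S x → (ℓ , c₀) #P X → (ℓ , c₀) #P Y →
                      SubP (openP X c₀) n x (openP Y c₀) → SubAbs ℓ X n x Y
SubAbs-fromInstance {ℓ} {l} {c₀} {X} {n} {x} {Y} c₀≢n c₀#x c₀#X c₀#Y D c c≢n c#x c#X c#Y =
  Sub-resp pred (swap-openP-fresh X c₀#X c#X) n-fixed (swap-fresh (sets l) ℓ c₀ c x c₀#x c#x)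
                (swap-openP-fresh Y c₀#Y c#Y) (Sub-swap pred ℓ c₀ c D)
  where
  n-fixed = cong proj₂ (swapAtom-fresh ℓ c₀ c (≢-sym c₀≢n) (≢-sym c≢n))

SubAbs-close : ∀ {ℓ l c₀} {X : Pred (ℓ ∷ [])} {n} {x : Sets [] l} {Y₀} →
               (ℓ , c₀) ≢ (l , n) → (ℓ , c₀) #S x → (ℓ , c₀) #P X →
               SubP (openP X c₀) n x Y₀ → SubAbs ℓ X n x (close ℓ c₀ Y₀)
SubAbs-close {ℓ} {c₀ = c₀} {Y₀ = Y₀} c₀≢n c₀#x c₀#X D =
  SubAbs-fromInstance c₀≢n c₀#x c₀#X (#-close ℓ c₀ Y₀) (subst (SubP _ _ _) (sym (openP-close ℓ c₀ Y₀)) D)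

mutual
  Sub-fresh-rename : ∀ s {Γ l n} {x : Sets [] l} (t : Term s Γ) (φ : NameMap Γ []) →
                     (l , n) ∉ fv s (rename s φ t) → Sub s (rename s φ t) n x (rename s φ t)
  Sub-fresh-rename pred (and Xs) φ n# = s-and (Sub-fresh-rename preds Xs φ n#)
  Sub-fresh-rename pred (neg X) φ n# = s-neg (Sub-fresh-rename pred X φ n#)
  Sub-fresh-rename pred (all ℓ X) φ n# = s-all (SubAbs-fresh-rename X φ n#)
  Sub-fresh-rename pred (elt {i} y a) φ n# with φ a
  ... | fr k = s-elt-other (λ k≡n → n# (∈-++⁺ʳ _ (Any.here (sym k≡n))))
                           (Sub-fresh-rename (sets i) y φ (n# ∘ ∈-++⁺ˡ))
  Sub-fresh-rename preds [] φ n# = s-[]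
  Sub-fresh-rename preds (X ∷ Xs) φ n# =
    s-∷ (Sub-fresh-rename pred X φ (n# ∘ ∈-++⁺ˡ)) (Sub-fresh-rename preds Xs φ (n# ∘ ∈-++⁺ʳ _))
  Sub-fresh-rename (sets k) (atm a) φ n# with φ a
  ... | fr m = s-atm-neq (λ m≡n → n# (Any.here (sym m≡n)))
  Sub-fresh-rename (sets k) (st X) φ n# = s-st (SubAbs-fresh-rename X φ n#)

  SubAbs-fresh-rename : ∀ {Γ ℓ l n} {x : Sets [] l} (X : Pred (ℓ ∷ Γ)) (φ : NameMap Γ []) →
                        (l , n) ∉ fvP (rename pred (⇑ φ) X) →
                        SubAbs ℓ (rename pred (⇑ φ) X) n x (rename pred (⇑ φ) X)
  SubAbs-fresh-rename X φ n# c c≢n _ _ _ =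
    subst (λ W → SubP W _ _ W) (sym (openP-rename-⇑ φ X c))
      (Sub-fresh-rename pred X (openᴺ c ∘ᴺ ⇑ φ)
        (subst (λ W → _ ∉ fvP W) (openP-rename-⇑ φ X c) (#-openP (rename pred (⇑ φ) X) c (≢-sym c≢n) n#)))

Sub-fresh : ∀ s {l n} {x : Sets [] l} (t : Term s []) → (l , n) ∉ fv s t → Sub s t n x t
Sub-fresh s t n# =
  subst (λ u → Sub s u _ _ u) (rename-id s t)
    (Sub-fresh-rename s t idᴺ (subst (λ u → _ ∉ fv s u) (sym (rename-id s t)) n#))

mutual
  Sub-renameAtom : ∀ s {l} {Z : Term s []} {n n′} {y : Sets [] l} {R} → Sub s Z n y R →
                   (l , n) ≢ (l , n′) → (l , n′) ∉ fv s Z → (l , n) ∉ fvS y → Sub s (swap s l n n′ Z) n′ y R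
  Sub-renameAtom pred (s-and D) n≢n′ n′#Z n#y = s-and (Sub-renameAtom preds D n≢n′ n′#Z n#y)
  Sub-renameAtom pred (s-neg D) n≢n′ n′#Z n#y = s-neg (Sub-renameAtom pred D n≢n′ n′#Z n#y)
  Sub-renameAtom pred (s-all D) n≢n′ n′#Z n#y = s-all (SubAbs-renameAtom D n≢n′ n′#Z n#y)
  Sub-renameAtom pred {l} {n = n} {n′} (s-elt-atm D) n≢n′ n′#Z n#y =
    Sub-resp pred (cong (elt _) (cong fr (sym (swapName-left l n n′)))) refl refl refl
      (s-elt-atm (Sub-renameAtom (sets _) D n≢n′ (n′#Z ∘ ∈-++⁺ˡ) n#y))
  Sub-renameAtom pred {l} {n = n} {n′} (s-elt-st D P) n≢n′ n′#Z n#y =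
    Sub-resp pred (cong (elt _) (cong fr (sym (swapName-left l n n′)))) refl refl refl
      (s-elt-st (Sub-renameAtom (sets _) D n≢n′ (n′#Z ∘ ∈-++⁺ˡ) n#y) P)
  Sub-renameAtom pred {l} {n = n} {n′} (s-elt-other m≢n D) n≢n′ n′#Z n#y =
    Sub-resp pred (cong (elt _) (cong fr (sym (cong proj₂ (swapAtom-fresh l n n′ m≢n m≢n′))))) refl refl refl
      (s-elt-other m≢n′ (Sub-renameAtom (sets _) D n≢n′ (n′#Z ∘ ∈-++⁺ˡ) n#y))
    where m≢n′ = λ m≡n′ → n′#Z (∈-++⁺ʳ _ (Any.here (sym m≡n′)))
  Sub-renameAtom preds s-[] n≢n′ n′#Z n#y = s-[]
  Sub-renameAtom preds (s-∷ D Ds) n≢n′ n′#Z n#y =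
    s-∷ (Sub-renameAtom pred D n≢n′ (n′#Z ∘ ∈-++⁺ˡ) n#y) (Sub-renameAtom preds Ds n≢n′ (n′#Z ∘ ∈-++⁺ʳ _) n#y)
  Sub-renameAtom (sets k) {l} {n = n} {n′} s-atm-eq n≢n′ n′#Z n#y =
    Sub-resp (sets k) (cong atm (cong fr (sym (swapName-left l n n′)))) refl refl refl s-atm-eq
  Sub-renameAtom (sets k) {l} {n = n} {n′} (s-atm-neq m≢n) n≢n′ n′#Z n#y =
    Sub-resp (sets k) (cong atm (cong fr (sym (cong proj₂ (swapAtom-fresh l n n′ m≢n m≢n′))))) refl refl refl
      (s-atm-neq m≢n′)
    where m≢n′ = λ m≡n′ → n′#Z (Any.here (sym m≡n′))
  Sub-renameAtom (sets k) (s-st D) n≢n′ n′#Z n#y = s-st (SubAbs-renameAtom D n≢n′ n′#Z n#y)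

  SubAbs-renameAtom : ∀ {ℓ l} {X : Pred (ℓ ∷ [])} {n n′} {y : Sets [] l} {Y} → SubAbs ℓ X n y Y →
                      (l , n) ≢ (l , n′) → (l , n′) ∉ fvP X → (l , n) ∉ fvS y →
                      SubAbs ℓ (rename pred (⇑ (swapᴺ l n n′)) X) n′ y Y
  SubAbs-renameAtom {ℓ} {l} {X} {n} {n′} {y} {Y} D n≢n′ n′#X n#y =
    case freshFor ℓ ((l , n) ∷ (l , n′) ∷ []) (fvS y ∷ fvP X ∷ fvP Y ∷ []) of λ where
      (c , c≢n ∷ c≢n′ ∷ [] , c#y ∷ c#X ∷ c#Y ∷ []) →
        let c-fixed = swapAtom-fresh l n n′ c≢n c≢n′
            πX≡ = rename-⇑-swapᴺ l n n′ X
        in SubAbs-fromInstance c≢n′ c#y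
             (subst (λ W → _ ∉ fvP W) (sym πX≡) (#-swap pred l n n′ X (subst (_∉ fvP X) (sym c-fixed) c#X)))
             c#Y
             (Sub-resp pred (trans (swap-openP l n n′ X c) (cong₂ openP (sym πX≡) (cong proj₂ c-fixed)))
                refl refl refl
                (Sub-renameAtom pred (D c c≢n c#y c#X c#Y) n≢n′ (#-openP X c (≢-sym c≢n′) n′#X) n#y))

-- m may occur in y: rather than swapping m₀ and m everywhere, only the substituted atom is renamed.
SubInst-fromInstance : ∀ {i m₀} {X : Pred (i ∷ [])} {y : Sets [] i} {R} → (i , m₀) #P X → (i , m₀) #S y →
                       SubP (openP X m₀) m₀ y R → SubInst i X y R
SubInst-fromInstance {i} {m₀} {X} {y} {R} m₀#X m₀#y D m m#X with m ℕ.≟ m₀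
... | yes refl = D
... | no m≢m₀ =
  subst (λ W → SubP W m y R) (swap-openP-fresh X m₀#X m#X)
    (Sub-renameAtom pred D (m≢m₀ ∘ sym ∘ cong proj₂) (#-openP X m₀ (m≢m₀ ∘ cong proj₂) m#X) m₀#y)

-- Levels of comprehensions

stLevels : ∀ s {Γ} → Term s Γ → List ℤ
stLevels pred (and Xs) = stLevels preds Xs
stLevels pred (neg X) = stLevels pred X
stLevels pred (all ℓ X) = stLevels pred X
stLevels pred (elt {i} y a) = stLevels (sets i) y
stLevels preds [] = []
stLevels preds (X ∷ Xs) = stLevels pred X ++ stLevels preds Xs
stLevels (sets k) (atm a) = []
stLevels (sets k) (st X) = k ∷ stLevels pred X

stLevels-rename : ∀ s {Γ Δ} (φ : NameMap Γ Δ) (t : Term s Γ) → stLevels s (rename s φ t) ≡ stLevels s t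
stLevels-rename pred φ (and Xs) = stLevels-rename preds φ Xs
stLevels-rename pred φ (neg X) = stLevels-rename pred φ X
stLevels-rename pred φ (all ℓ X) = stLevels-rename pred (⇑ φ) X
stLevels-rename pred φ (elt {i} y a) = stLevels-rename (sets i) φ y
stLevels-rename preds φ [] = refl
stLevels-rename preds φ (X ∷ Xs) = cong₂ _++_ (stLevels-rename pred φ X) (stLevels-rename preds φ Xs)
stLevels-rename (sets k) φ (atm a) = refl
stLevels-rename (sets k) φ (st X) = cong (k ∷_) (stLevels-rename pred (⇑ φ) X)

stLevels-openP : ∀ {ℓ} (X : Pred (ℓ ∷ [])) c → stLevels pred (openP X c) ≡ stLevels pred X
stLevels-openP X c = trans (cong (stLevels pred) (openP≡rename X c)) (stLevels-rename pred (openᴺ c) X)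

mutual
  Sub-stLevels : ∀ (P : ℤ → Set) s {l} {Z : Term s []} {n} {x : Sets [] l} {Y} → Sub s Z n x Y →
                 All P (stLevels s Z) → All P (stLevels (sets l) x) → All P (stLevels s Y)
  Sub-stLevels P pred (s-and D) pZ px = Sub-stLevels P preds D pZ px
  Sub-stLevels P pred (s-neg D) pZ px = Sub-stLevels P pred D pZ px
  Sub-stLevels P pred (s-all D) pZ px = SubAbs-stLevels P D pZ px
  Sub-stLevels P pred (s-elt-atm D) pZ px = Sub-stLevels P (sets _) D pZ px
  Sub-stLevels P pred (s-elt-st D Q) pZ px =
    SubInst-stLevels P Q (All.tail px) (Sub-stLevels P (sets _) D pZ px)
  Sub-stLevels P pred (s-elt-other _ D) pZ px = Sub-stLevels P (sets _) D pZ px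
  Sub-stLevels P preds s-[] pZ px = []
  Sub-stLevels P preds (s-∷ {X = X} D Ds) pZ px =
    ++⁺ (Sub-stLevels P pred D (++⁻ˡ (stLevels pred X) pZ) px)
        (Sub-stLevels P preds Ds (++⁻ʳ (stLevels pred X) pZ) px)
  Sub-stLevels P (sets k) s-atm-eq pZ px = px
  Sub-stLevels P (sets k) (s-atm-neq _) pZ px = pZ
  Sub-stLevels P (sets k) (s-st D) (pk ∷ pZ) px = pk ∷ SubAbs-stLevels P D pZ px

  SubAbs-stLevels : ∀ (P : ℤ → Set) {ℓ l} {X : Pred (ℓ ∷ [])} {n} {x : Sets [] l} {Y} → SubAbs ℓ X n x Y →
                    All P (stLevels pred X) → All P (stLevels (sets l) x) → All P (stLevels pred Y)
  SubAbs-stLevels P {ℓ} {l} {X} {n} {x} {Y} D pX px =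
    case freshFor ℓ ((l , n) ∷ []) (fvS x ∷ fvP X ∷ fvP Y ∷ []) of λ where
      (c , c≢n ∷ [] , c#x ∷ c#X ∷ c#Y ∷ []) →
        subst (All P) (stLevels-openP Y c)
          (Sub-stLevels P pred (D c c≢n c#x c#X c#Y) (subst (All P) (sym (stLevels-openP X c)) pX) px)

  SubInst-stLevels : ∀ (P : ℤ → Set) {i} {X : Pred (i ∷ [])} {y R} → SubInst i X y R →
                     All P (stLevels pred X) → All P (stLevels (sets i) y) → All P (stLevels pred R)
  SubInst-stLevels P {i} {X} Q pX py = case freshFor i [] (fvP X ∷ []) of λ where
    (m , [] , m#X ∷ []) → Sub-stLevels P pred (Q m m#X) (subst (All P) (sym (stLevels-openP X m)) pX) py

Above : ℤ → ∀ s {Γ} → Term s Γ → Set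
Above L s t = All (L ≤_) (stLevels s t)

Above-rename : ∀ L s {Γ Δ} (φ : NameMap Γ Δ) (t : Term s Γ) → Above L s t → Above L s (rename s φ t)
Above-rename L s φ t = subst (All (L ≤_)) (sym (stLevels-rename s φ t))

Above-openP : ∀ L {ℓ} (X : Pred (ℓ ∷ [])) c → Above L pred X → Above L pred (openP X c)
Above-openP L X c = subst (All (L ≤_)) (sym (stLevels-openP X c))

-- i < + h + L: a substitution for an atom of level i recurses through s-elt-st at most h times,
-- as each recursion lowers the level by one and no comprehension lies below L.

no-fuel : ∀ {L l} → L ≤ l → l < + 0 + L → ⊥
no-fuel {L} {l} L≤l l<L = <⇒≱ (subst (l <_) (+-identityˡ L) l<L) L≤l

fuel-pred : ∀ {L i} h → suc i < + ℕ.suc h + L → i < + h + L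
fuel-pred {L} {i} h lt =
  subst₂ _<_ (pred-suc i) (pred-suc _) (+-monoʳ-< -1ℤ (subst (suc i <_) (suc-+ h L) lt))

fuel-exists : ∀ L l → ∃ λ h → l < + h + L
fuel-exists L l = ℕ.suc d , (begin-strict
  l               ≡⟨ +-identityʳ l ⟨
  l + 0ℤ          ≡⟨ cong (_+_ l) (+-inverseˡ L) ⟨
  l + (- L + L)   ≡⟨ +-assoc l (- L) L ⟨
  l - L + L       ≤⟨ +-monoˡ-≤ L (i≤∣i∣ (l - L)) ⟩
  + d + L         <⟨ +-monoˡ-< L (+<+ (ℕ.n<1+n d)) ⟩
  + ℕ.suc d + L   ∎)
  where
  open ≤-Reasoning
  d = ∣ l - L ∣
  i≤∣i∣ : ∀ i → i ≤ + ∣ i ∣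
  i≤∣i∣ (+ n)    = ≤-refl
  i≤∣i∣ -[1+ n ] = -≤+

-- Totality of the substitution relation

suc-injective : ∀ {i j} → suc i ≡ suc j → i ≡ j
suc-injective {i} {j} eq = trans (sym (pred-suc i)) (trans (cong (_+_ -1ℤ) eq) (pred-suc j))

Sub-atm-total : ∀ {k l} n (x : Sets [] l) (b : Name [] k) → ∃ (SubS (atm b) n x)
Sub-atm-total {k} {l} n x (fr m) with (k , m) ≟A (l , n)
... | yes refl = x , s-atm-eq
... | no m≢n   = atm (fr m) , s-atm-neq m≢n

mutual
  Sub-total-rename : ∀ L s {Γ} (t : Term s Γ) (φ : NameMap Γ []) {l} h n (x : Sets [] l) →
                     Above L s t → Above L (sets l) x → l < + h + L → ∃ (Sub s (rename s φ t) n x)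
  Sub-total-rename L pred (and Xs) φ h n x At Ax fuel =
    let Ys , D = Sub-total-rename L preds Xs φ h n x At Ax fuel in and Ys , s-and D
  Sub-total-rename L pred (neg X) φ h n x At Ax fuel =
    let Y , D = Sub-total-rename L pred X φ h n x At Ax fuel in neg Y , s-neg D
  Sub-total-rename L pred (all ℓ X) φ h n x At Ax fuel =
    let Y , D = SubAbs-total-rename L X φ h n x At Ax fuel in all ℓ Y , s-all D
  Sub-total-rename L pred (elt {i} y a) φ h n x At Ax fuel =
    let y′ , Dy = Sub-total-rename L (sets i) y φ h n x At Ax fuel
        Ay′ = Sub-stLevels (L ≤_) (sets i) Dy (Above-rename L (sets i) φ y At) Ax
    in Sub-elt-total L h n x (φ a) Dy Ay′ Ax fuel
  Sub-total-rename L preds [] φ h n x At Ax fuel = [] , s-[]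
  Sub-total-rename L preds (X ∷ Xs) φ h n x At Ax fuel =
    let Y , D = Sub-total-rename L pred X φ h n x (++⁻ˡ (stLevels pred X) At) Ax fuel
        Ys , Ds = Sub-total-rename L preds Xs φ h n x (++⁻ʳ (stLevels pred X) At) Ax fuel
    in Y ∷ Ys , s-∷ D Ds
  Sub-total-rename L (sets k) (atm a) φ h n x At Ax fuel = Sub-atm-total n x (φ a)
  Sub-total-rename L (sets k) (st X) φ h n x (_ ∷ At) Ax fuel =
    let Y , D = SubAbs-total-rename L X φ h n x At Ax fuel in st Y , s-st D

  SubAbs-total-rename : ∀ L {Γ ℓ} (X : Pred (ℓ ∷ Γ)) (φ : NameMap Γ []) {l} h n (x : Sets [] l) →
                        Above L pred X → Above L (sets l) x → l < + h + L →
                        ∃ (SubAbs ℓ (rename pred (⇑ φ) X) n x)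
  SubAbs-total-rename L {ℓ = ℓ} X φ {l} h n x AX Ax fuel =
    case freshFor ℓ ((l , n) ∷ []) (fvS x ∷ fvP (rename pred (⇑ φ) X) ∷ []) of λ where
      (c , c≢n ∷ [] , c#x ∷ c#X ∷ []) →
        let Y , D = Sub-total-rename L pred X (openᴺ c ∘ᴺ ⇑ φ) h n x AX Ax fuel
        in close ℓ c Y , SubAbs-close c≢n c#x c#X (subst (λ W → SubP W n x Y) (sym (openP-rename-⇑ φ X c)) D)

  Sub-elt-total : ∀ L {i l} h n (x : Sets [] l) {y y′ : Sets [] i} (b : Name [] (suc i)) → SubS y n x y′ →
                  Above L (sets i) y′ → Above L (sets l) x → l < + h + L → ∃ (SubP (elt y b) n x)
  Sub-elt-total L {i} {l} h n (atm (fr n′)) (fr k) Dy Ay′ Ax fuel with (suc i , k) ≟A (l , n)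
  ... | yes refl = _ , s-elt-atm Dy
  ... | no k≢n   = _ , s-elt-other k≢n Dy
  Sub-elt-total L {i} h n (st {j} X) (fr k) Dy Ay′ (L≤ ∷ AX) fuel with (suc i , k) ≟A (suc j , n)
  ... | no k≢n = _ , s-elt-other k≢n Dy
  ... | yes k≡n with suc-injective {i} {j} (cong proj₁ k≡n) | cong proj₂ k≡n
  ...   | refl | refl = let R , P = SubInst-total L h X _ L≤ AX Ay′ fuel in R , s-elt-st Dy P

  SubInst-total : ∀ L {i} h (X : Pred (i ∷ [])) (y : Sets [] i) → L ≤ suc i →
                  Above L pred X → Above L (sets i) y → suc i < + h + L → ∃ (SubInst i X y)
  SubInst-total L ℕ.zero X y L≤ AX Ay fuel = ⊥-elim (no-fuel L≤ fuel)
  SubInst-total L {i} (ℕ.suc h) X y L≤ AX Ay fuel = case freshFor i [] (fvP X ∷ fvS y ∷ []) of λ where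
    (m , [] , m#X ∷ m#y ∷ []) →
      let R , D = Sub-total-rename L pred X (openᴺ m) h m y AX Ay (fuel-pred {L} h fuel)
      in R , SubInst-fromInstance m#X m#y (subst (λ W → SubP W m y R) (sym (openP≡rename X m)) D)

Sub-total : ∀ L s {l} h (t : Term s []) n (x : Sets [] l) →
            Above L s t → Above L (sets l) x → l < + h + L → ∃ (Sub s t n x)
Sub-total L s h t n x At Ax fuel =
  let Y , D = Sub-total-rename L s t idᴺ h n x At Ax fuel in Y , subst (λ u → Sub s u n x Y) (rename-id s t) D

-- Commutation of substitutions

m+n<n+1+m : ∀ m n → m ℕ.+ n ℕ.< n ℕ.+ ℕ.suc m
m+n<n+1+m m n = subst (m ℕ.+ n ℕ.<_) (sym (ℕ.+-suc n m)) (ℕ.s≤s (ℕ.≤-reflexive (ℕ.+-comm m n)))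

Commutes : ∀ s {i j} → ℕ → Sets [] i → ℕ → Sets [] j → Term s [] → Set
Commutes s {i} a x b y Z = ∀ {Z₁ Z₂ Z₃ Z₄} {x′ : Sets [] i} →
  Sub s Z a x Z₁ → Sub s Z₁ b y Z₂ → Sub s Z b y Z₃ → SubS x b y x′ → Sub s Z₃ a x′ Z₄ → Z₂ ≡ Z₄

record Premises (L : ℤ) {i j} (a : ℕ) (x : Sets [] i) (b : ℕ) (y : Sets [] j) (h₁ h₂ : ℕ) : Set where
  field
    a≢b     : (i , a) ≢ (j , b)
    a#y     : (i , a) #S y
    x-above : Above L (sets i) x
    y-above : Above L (sets j) y
    x-fuel  : i < + h₁ + L
    y-fuel  : j < + h₂ + L

module Commutation (L : ℤ) where
  open Premises

  CommuteAt : ℕ → Set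
  CommuteAt n = ∀ s {i j a b h₁ h₂} {x : Sets [] i} {y : Sets [] j} → h₁ ℕ.+ h₂ ≡ n →
                Premises L a x b y h₁ h₂ → ∀ {Z} → Above L s Z → Commutes s a x b y Z

  module Step {n} (ih : ∀ {m} → m ℕ.< n → CommuteAt m) where
    mutual
      commute : CommuteAt n
      commute pred h≡n S AZ (s-and D₁) (s-and D₂) (s-and D₃) Dx (s-and D₄) =
        cong and (commute preds h≡n S AZ D₁ D₂ D₃ Dx D₄)
      commute pred h≡n S AZ (s-neg D₁) (s-neg D₂) (s-neg D₃) Dx (s-neg D₄) =
        cong neg (commute pred h≡n S AZ D₁ D₂ D₃ Dx D₄)
      commute pred h≡n S AZ (s-all D₁) (s-all D₂) (s-all D₃) Dx (s-all D₄) =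
        cong (all _) (commute-abs h≡n S AZ D₁ D₂ D₃ Dx D₄)
      commute pred h≡n S AZ (s-elt-atm D₁) D₂ D₃ Dx D₄ = commute-elt-atm h≡n S AZ D₁ D₂ D₃ Dx D₄
      commute pred h≡n S AZ (s-elt-st D₁ P₁) D₂ (s-elt-other _ D₃) (s-st Px) (s-elt-st D₄ P₄) =
        commute-elt-x-st h≡n S AZ D₁ P₁ D₂ D₃ Px D₄ P₄
      commute pred h≡n S AZ (s-elt-st _ _) D₂ (s-elt-other _ _) (s-st _) (s-elt-other a≢a _) =
        ⊥-elim (a≢a refl)
      commute pred h≡n S AZ (s-elt-st _ _) D₂ (s-elt-atm _) Dx D₄ = ⊥-elim (a≢b S refl)
      commute pred h≡n S AZ (s-elt-st _ _) D₂ (s-elt-st _ _) Dx D₄ = ⊥-elim (a≢b S refl)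
      commute pred h≡n S AZ (s-elt-other c≢a D₁) D₂ D₃ Dx D₄ = commute-elt-other h≡n S AZ c≢a D₁ D₂ D₃ Dx D₄
      commute preds h≡n S AZ s-[] s-[] s-[] Dx s-[] = refl
      commute preds h≡n S AZ (s-∷ {X = X} D₁ E₁) (s-∷ D₂ E₂) (s-∷ D₃ E₃) Dx (s-∷ D₄ E₄) =
        cong₂ _∷_ (commute pred h≡n S (++⁻ˡ (stLevels pred X) AZ) D₁ D₂ D₃ Dx D₄)
                  (commute preds h≡n S (++⁻ʳ (stLevels pred X) AZ) E₁ E₂ E₃ Dx E₄)
      commute (sets k) h≡n S AZ s-atm-eq D₂ (s-atm-neq _) Dx s-atm-eq = Sub-functional (sets k) D₂ Dx
      commute (sets k) h≡n S AZ s-atm-eq D₂ (s-atm-neq _) Dx (s-atm-neq a≢a) = ⊥-elim (a≢a refl)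
      commute (sets k) h≡n S AZ s-atm-eq D₂ s-atm-eq Dx D₄ = ⊥-elim (a≢b S refl)
      commute (sets k) h≡n S AZ (s-atm-neq _) s-atm-eq s-atm-eq Dx D₄ =
        Sub-functional (sets k) (Sub-fresh (sets k) _ (a#y S)) D₄
      commute (sets k) h≡n S AZ (s-atm-neq _) s-atm-eq (s-atm-neq b≢b) Dx D₄ = ⊥-elim (b≢b refl)
      commute (sets k) h≡n S AZ (s-atm-neq _) (s-atm-neq _) (s-atm-neq _) Dx (s-atm-neq _) = refl
      commute (sets k) h≡n S AZ (s-atm-neq c≢a) (s-atm-neq _) (s-atm-neq _) Dx s-atm-eq = ⊥-elim (c≢a refl)
      commute (sets k) h≡n S AZ (s-atm-neq _) (s-atm-neq c≢b) s-atm-eq Dx D₄ = ⊥-elim (c≢b refl)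
      commute (sets k) h≡n S (_ ∷ AZ) (s-st D₁) (s-st D₂) (s-st D₃) Dx (s-st D₄) =
        cong st (commute-abs h≡n S AZ D₁ D₂ D₃ Dx D₄)

      commute-abs : ∀ {ℓ i j a b h₁ h₂} {x : Sets [] i} {y : Sets [] j} → h₁ ℕ.+ h₂ ≡ n →
                    Premises L a x b y h₁ h₂ → ∀ {X X₁ X₂ X₃ X₄ : Pred (ℓ ∷ [])} {x′} → Above L pred X →
                    SubAbs ℓ X a x X₁ → SubAbs ℓ X₁ b y X₂ → SubAbs ℓ X b y X₃ → SubS x b y x′ →
                    SubAbs ℓ X₃ a x′ X₄ → X₂ ≡ X₄
      commute-abs {ℓ} {i} {j} {a} {b} {x = x} {y} h≡n S {X} {X₁} {X₂} {X₃} {X₄} {x′} AX D₁ D₂ D₃ Dx D₄ =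
        case freshFor ℓ ((i , a) ∷ (j , b) ∷ [])
               (fvS x ∷ fvS y ∷ fvS x′ ∷ fvP X ∷ fvP X₁ ∷ fvP X₂ ∷ fvP X₃ ∷ fvP X₄ ∷ []) of λ where
          (c , c≢a ∷ c≢b ∷ [] , c#x ∷ c#y ∷ c#x′ ∷ c#X ∷ c#X₁ ∷ c#X₂ ∷ c#X₃ ∷ c#X₄ ∷ []) →
            openP-injective c#X₂ c#X₄
              (commute pred h≡n S (Above-openP L X c AX)
                 (D₁ c c≢a c#x c#X c#X₁) (D₂ c c≢b c#y c#X₁ c#X₂) (D₃ c c≢b c#y c#X c#X₃) Dx
                 (D₄ c c≢a c#x′ c#X₃ c#X₄))

      commute-elt-atm : ∀ {i j a b h₁ h₂ n′} {y : Sets [] j} → h₁ ℕ.+ h₂ ≡ n →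
                        Premises L {suc i} a (atm (fr n′)) b y h₁ h₂ →
                        ∀ {w w₁ : Sets [] i} {Z₂ Z₃ Z₄ x′} → Above L (sets i) w →
                        SubS w a (atm (fr n′)) w₁ → SubP (elt w₁ (fr n′)) b y Z₂ →
                        SubP (elt w (fr a)) b y Z₃ → SubS (atm (fr n′)) b y x′ → SubP Z₃ a x′ Z₄ → Z₂ ≡ Z₄
      commute-elt-atm h≡n S Aw D₁ D₂ (s-elt-atm _) Dx D₄ = ⊥-elim (a≢b S refl)
      commute-elt-atm h≡n S Aw D₁ D₂ (s-elt-st _ _) Dx D₄ = ⊥-elim (a≢b S refl)
      commute-elt-atm h≡n S Aw D₁ (s-elt-other _ D₂) (s-elt-other _ D₃) Dx@(s-atm-neq _) (s-elt-atm D₄) =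
        cong (λ v → elt v _) (commute (sets _) h≡n S Aw D₁ D₂ D₃ Dx D₄)
      commute-elt-atm h≡n S Aw D₁ (s-elt-atm D₂) (s-elt-other _ D₃) Dx@s-atm-eq (s-elt-atm D₄) =
        cong (λ v → elt v _) (commute (sets _) h≡n S Aw D₁ D₂ D₃ Dx D₄)
      commute-elt-atm h≡n S Aw D₁ (s-elt-st D₂ P₂) (s-elt-other _ D₃) Dx@s-atm-eq (s-elt-st D₄ P₄)
        with commute (sets _) h≡n S Aw D₁ D₂ D₃ Dx D₄
      ... | refl = SubInst-functional P₂ P₄
      commute-elt-atm h≡n S Aw D₁ D₂ (s-elt-other _ _) Dx (s-elt-other a≢a _) = ⊥-elim (a≢a refl)
      commute-elt-atm h≡n S Aw D₁ (s-elt-other b≢b _) (s-elt-other _ _) s-atm-eq D₄ = ⊥-elim (b≢b refl)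
      commute-elt-atm h≡n S Aw D₁ (s-elt-atm _) (s-elt-other _ _) (s-atm-neq n′≢b) D₄ = ⊥-elim (n′≢b refl)
      commute-elt-atm h≡n S Aw D₁ (s-elt-st _ _) (s-elt-other _ _) (s-atm-neq n′≢b) D₄ = ⊥-elim (n′≢b refl)

      commute-elt-other : ∀ {i j a b h₁ h₂ k c} {x : Sets [] i} {y : Sets [] j} → h₁ ℕ.+ h₂ ≡ n →
                          Premises L a x b y h₁ h₂ → ∀ {w w₁ : Sets [] k} {Z₂ Z₃ Z₄ x′} → Above L (sets k) w →
                          (suc k , c) ≢ (i , a) → SubS w a x w₁ → SubP (elt w₁ (fr c)) b y Z₂ →
                          SubP (elt w (fr c)) b y Z₃ → SubS x b y x′ → SubP Z₃ a x′ Z₄ → Z₂ ≡ Z₄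
      commute-elt-other h≡n S Aw _ D₁ (s-elt-other _ D₂) (s-elt-other _ D₃) Dx (s-elt-other _ D₄) =
        cong (λ v → elt v _) (commute (sets _) h≡n S Aw D₁ D₂ D₃ Dx D₄)
      commute-elt-other h≡n S Aw c≢a D₁ D₂ (s-elt-other _ _) Dx (s-elt-atm _) = ⊥-elim (c≢a refl)
      commute-elt-other h≡n S Aw c≢a D₁ D₂ (s-elt-other _ _) Dx (s-elt-st _ _) = ⊥-elim (c≢a refl)
      commute-elt-other h≡n S Aw _ D₁ (s-elt-atm _) (s-elt-other c≢b _) Dx D₄ = ⊥-elim (c≢b refl)
      commute-elt-other h≡n S Aw _ D₁ (s-elt-st _ _) (s-elt-other c≢b _) Dx D₄ = ⊥-elim (c≢b refl)
      commute-elt-other h≡n S Aw _ D₁ (s-elt-atm D₂) (s-elt-atm D₃) Dx (s-elt-other _ D₄) =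
        cong (λ v → elt v _) (commute (sets _) h≡n S Aw D₁ D₂ D₃ Dx D₄)
      commute-elt-other h≡n S Aw _ D₁ (s-elt-atm _) (s-elt-atm _) Dx (s-elt-atm _) =
        ⊥-elim (a#y S (Any.here refl))
      commute-elt-other h≡n S Aw _ D₁ (s-elt-atm _) (s-elt-atm _) Dx (s-elt-st _ _) =
        ⊥-elim (a#y S (Any.here refl))
      commute-elt-other h≡n S Aw _ D₁ (s-elt-other b≢b _) (s-elt-atm _) Dx D₄ = ⊥-elim (b≢b refl)
      commute-elt-other h≡n S Aw _ D₁ (s-elt-other b≢b _) (s-elt-st _ _) Dx D₄ = ⊥-elim (b≢b refl)
      commute-elt-other h≡n S Aw _ D₁ (s-elt-st D₂ P₂) (s-elt-st D₃ P₃) Dx D₄ =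
        commute-elt-y-st h≡n S Aw D₁ D₂ P₂ D₃ P₃ Dx D₄

      -- elt(w,a)[a ↦ st([m]X)] = X[m ↦ w₁]; by the induction hypothesis for the lower atom m,
      -- X[m ↦ w₁][b ↦ y] = X[b ↦ y][m ↦ w₁[b ↦ y]], and w₁[b ↦ y] = w₄ by induction on w.
      commute-elt-x-st : ∀ {i j a b h₁ h₂} {X : Pred (i ∷ [])} {y : Sets [] j} → h₁ ℕ.+ h₂ ≡ n →
                         Premises L {suc i} a (st X) b y h₁ h₂ →
                         ∀ {w w₁ w₃ w₄ : Sets [] i} {R Z₂ Z₄ X′} → Above L (sets i) w →
                         SubS w a (st X) w₁ → SubInst i X w₁ R → SubP R b y Z₂ →
                         SubS w b y w₃ → SubAbs i X b y X′ →
                         SubS w₃ a (st X′) w₄ → SubInst i X′ w₄ Z₄ → Z₂ ≡ Z₄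
      commute-elt-x-st {h₁ = ℕ.zero} _ S _ _ _ _ _ _ _ _ = ⊥-elim (no-fuel (All.head (x-above S)) (x-fuel S))
      commute-elt-x-st {i} {j} {a} {b} {ℕ.suc h₁} {h₂} {X} {y} h≡n S {w₁ = w₁} {Z₄ = Z₄} {X′}
                       Aw D₁ P₁ D₂ D₃ Px D₄ P₄ =
        case freshFor i ((j , b) ∷ []) (fvP X ∷ fvP X′ ∷ fvS y ∷ []) of λ where
          (m , m≢b ∷ [] , m#X ∷ m#X′ ∷ m#y ∷ []) →
            let Aw₁ = Sub-stLevels (L ≤_) (sets i) D₁ Aw (x-above S)
                w₅ , D₅ = Sub-total L (sets i) h₂ w₁ b y Aw₁ (y-above S) (y-fuel S)
                w₅≡w₄ = commute (sets i) h≡n S Aw D₁ D₅ D₃ (s-st Px) D₄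
                S′ = record { a≢b = m≢b ; a#y = m#y ; x-above = Aw₁ ; y-above = y-above S
                            ; x-fuel = fuel-pred {L} h₁ (x-fuel S) ; y-fuel = y-fuel S }
                smaller = subst (h₁ ℕ.+ h₂ ℕ.<_) h≡n ℕ.≤-refl
            in ih smaller pred refl S′ (Above-openP L X m (All.tail (x-above S)))
                 (P₁ m m#X) D₂ (Px m m≢b m#y m#X m#X′) D₅
                 (subst (λ v → SubP (openP X′ m) m v Z₄) (sym w₅≡w₄) (P₄ m m#X′))

      -- The mirror image of commute-elt-x-st, with the roles of the two substitutions exchanged;
      -- Y[a ↦ x′] = Y because a # y.
      commute-elt-y-st : ∀ {i j a b h₁ h₂} {x : Sets [] i} {Y : Pred (j ∷ [])} → h₁ ℕ.+ h₂ ≡ n →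
                         Premises L {j = suc j} a x b (st Y) h₁ h₂ →
                         ∀ {w w₁ w₂ w₃ : Sets [] j} {Z₂ Z₃ Z₄ x′} → Above L (sets j) w →
                         SubS w a x w₁ → SubS w₁ b (st Y) w₂ → SubInst j Y w₂ Z₂ →
                         SubS w b (st Y) w₃ → SubInst j Y w₃ Z₃ →
                         SubS x b (st Y) x′ → SubP Z₃ a x′ Z₄ → Z₂ ≡ Z₄
      commute-elt-y-st {h₂ = ℕ.zero} _ S _ _ _ _ _ _ _ _ = ⊥-elim (no-fuel (All.head (y-above S)) (y-fuel S))
      commute-elt-y-st {i} {j} {a} {b} {h₁} {ℕ.suc h₂} {x} {Y} h≡n S {w₃ = w₃} {Z₂ = Z₂} {x′ = x′}
                       Aw D₁ D₂ P₂ D₃ P₃ Dx D₄ =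
        case freshFor j ((i , a) ∷ []) (fvP Y ∷ fvS x′ ∷ []) of λ where
          (m , m≢a ∷ [] , m#Y ∷ m#x′ ∷ []) →
            let Ax′ = Sub-stLevels (L ≤_) (sets i) Dx (x-above S) (y-above S)
                Aw₃ = Sub-stLevels (L ≤_) (sets j) D₃ Aw (y-above S)
                w₅ , D₅ = Sub-total L (sets j) h₁ w₃ a x′ Aw₃ Ax′ (x-fuel S)
                w₂≡w₅ = commute (sets j) h≡n S Aw D₁ D₂ D₃ Dx D₅
                S′ = record { a≢b = m≢a ; a#y = m#x′ ; x-above = Aw₃ ; y-above = Ax′
                            ; x-fuel = fuel-pred {L} h₂ (y-fuel S) ; y-fuel = x-fuel S }
                smaller = subst (h₂ ℕ.+ h₁ ℕ.<_) h≡n (m+n<n+1+m h₂ h₁)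
            in sym (ih smaller pred refl S′ (Above-openP L Y m (All.tail (y-above S)))
                      (P₃ m m#Y) D₄ (Sub-fresh pred (openP Y m) (#-openP Y m (≢-sym m≢a) (a#y S))) D₅
                      (subst (λ v → SubP (openP Y m) m v Z₂) w₂≡w₅ (P₂ m m#Y)))

  commute : ∀ n → CommuteAt n
  commute = <-rec CommuteAt (λ n ih → Step.commute ih)

commutes : ∀ s {i j a b} {x : Sets [] i} {y : Sets [] j} → (i , a) ≢ (j , b) → (i , a) #S y →
           (Z : Term s []) → Commutes s a x b y Z
commutes s {i} {j} {x = x} {y} a≢b a#y Z =
  Commutation.commute L _ s refl premises (++⁻ˡ (stLevels s Z) above)
  where
  open import Data.List.Extrema Data.Integer.Properties.≤-totalOrder using (min; min≤xs)
  levels = stLevels s Z ++ stLevels (sets i) x ++ stLevels (sets j) y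
  L = min 0ℤ levels
  above = min≤xs 0ℤ levels
  x&y-above = ++⁻ʳ (stLevels s Z) above
  premises : Premises L _ x _ y _ _
  premises = record { a≢b = a≢b ; a#y = a#y
                 ; x-above = ++⁻ˡ (stLevels (sets i) x) x&y-above
                 ; y-above = ++⁻ʳ (stLevels (sets i) x) x&y-above
                 ; x-fuel = proj₂ (fuel-exists L i) ; y-fuel = proj₂ (fuel-exists L j) }

proposition4p13 : ∀ (i j : ℤ) (a : ℕ) (x : Sets [] i) (b : ℕ) (y : Sets [] j) →
    (i , a) ≢ (j , b) → (i , a) #S y →
    (∀ (Z Z₁ Z₂ Z₃ Z₄ : Pred []) (x' : Sets [] i) →
       SubP Z a x Z₁ → SubP Z₁ b y Z₂ →
       SubP Z b y Z₃ → SubS x b y x' → SubP Z₃ a x' Z₄ →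
       Z₂ ≡ Z₄)
    × (∀ (k : ℤ) (z z₁ z₂ z₃ z₄ : Sets [] k) (x' : Sets [] i) →
       SubS z a x z₁ → SubS z₁ b y z₂ →
       SubS z b y z₃ → SubS x b y x' → SubS z₃ a x' z₄ →
       z₂ ≡ z₄)
proposition4p13 i j a x b y a≢b a#y =
  (λ Z _ _ _ _ _ → commutes pred a≢b a#y Z) , (λ k z _ _ _ _ _ → commutes (sets k) a≢b a#y z)
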